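{- Let $X$ be a $k$-dimensional simplicial complex with vertex set $[n]$ and complete $(k-1)$-skeleton, fix $d>0$, let $E=D_{k-1}(X)-dI$, and let $b\in B^{k-1}(X)$. For every $F\in X_{k-2}$ define $h_b(F):=\sum_{v\in[n]\setminus F}[F\cup\{v\}:F]\,b(F\cup\{v\})$. Then: (a) $b(H)=\frac1n\sum_{F\in X_{k-2},\,F\subset H}[H:F]\,h_b(F)$ for every $H\in X_{k-1}$; (b) $\langle Eb,Eb\rangle\leq \frac{k}{n^2}\sum_{F\in X_{k-2}}h_b(F)^2\,\langle E\delta_{k-2}e_F,E\delta_{k-2}e_F\rangle$; (c) $\sum_{F\in X_{k-2}}h_b(F)^2\leq k(n-k+1)\langle b,b\rangle$.
   Context: A simplicial complex $X$ is a finite family of sets closed under subsets; $X_i$ is the set of faces with $i+1$ elements; $[n]$ is ordered naturally. Complete $(k-1)$-skeleton: every subset of $[n]$ of size at most $k$ is a face. For an $i$-face $F=\{v_0<\dots<v_i\}$ and $(i-1)$-face $G$, $[F:G]=(-1)^j$ if $G=F\setminus\{v_j\}$, and $0$ if $G\not\subseteq F$. $C^i(X;\mathbb{R})=\mathbb{R}^{X_i}$ with standard inner product $\langle f,g\rangle=\sum_F f(F)g(F)$; $e_F$ is the indicator cochain of $F$; the coboundary is $(\delta_i f)(H)=\sum_{G\in X_i}[H:G]f(G)$; $B^{k-1}(X)=\mathrm{im}\,\delta_{k-2}$. $D_{k-1}(X)$ is the diagonal matrix whose entry at $F\in X_{k-1}$ is the number of $k$-faces containing $F$.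
   Formalization: The cochains, in particular b and its preimage under $\delta_{k-2}$, and the parameter d take values in ℚ rather than ℝ. -}

module Defs where

open import Data.Bool using (Bool; true; false; _∧_; if_then_else_)
open import Data.Nat as ℕ using (ℕ; zero; suc)
open import Data.Integer using (+_)
open import Data.Rational using (ℚ; 0ℚ; 1ℚ; _+_; _*_; _-_; _/_)
open import Data.List using (List; []; _∷_; _++_; map; filter; foldr; length)
open import Data.Vec using ([]; _∷_)
open import Data.Vec.Properties using (≡-dec)
open import Data.Fin using (Fin)
open import Data.List using () renaming (allFin to allFinL)
open import Data.Fin.Subset using (Subset; ∣_∣; _∈_; _∉_; _∪_; ⁅_⁆) renaming (_-_ to _∖_)
open import Data.Fin.Subset.Properties using (_∈?_; _⊆?_)
open import Relation.Nullary.Decidable using (⌊_⌋; ¬?)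
import Data.Bool.Properties as BoolP
import Data.Nat.Properties as NatP

ℚ[_] : ℕ → ℚ
ℚ[ m ] = + m / 1

Σ[_]_ : {A : Set} → List A → (A → ℚ) → ℚ
Σ[ xs ] f = foldr (λ x acc → f x + acc) 0ℚ xs

altΣ : {A : Set} → List A → (A → ℚ) → ℚ
altΣ []       f = 0ℚ
altΣ (x ∷ xs) f = f x - altΣ xs f

allSubsets : (n : ℕ) → List (Subset n)
allSubsets zero    = [] ∷ []
allSubsets (suc n) = map (false ∷_) (allSubsets n) ++ map (true ∷_) (allSubsets n)

-- All subsets of [n] with exactly c elements (i.e. all (c-1)-dimensional sets).
sets : (n c : ℕ) → List (Subset n)
sets n c = filter (λ S → ∣ S ∣ ℕ.≟ c) (allSubsets n)

_≟S_ : {n : ℕ} → (S T : Subset n) → _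
_≟S_ = ≡-dec BoolP._≟_

elems : {n : ℕ} → Subset n → List (Fin n)
elems {n} S = filter (_∈? S) (allFinL n)

-- Incidence number [F : G] = (-1)^j if G = F \ {v_j} (F = {v_0 < ... < v_i}),
-- and 0 if G is not of that form.
[_∶_] : {n : ℕ} → Subset n → Subset n → ℚ
[ F ∶ G ] = altΣ (elems F) (λ v → if ⌊ G ≟S (F ∖ v) ⌋ then 1ℚ else 0ℚ)

e : {n : ℕ} → Subset n → Subset n → ℚ
e F G = if ⌊ G ≟S F ⌋ then 1ℚ else 0ℚ

-- Cochains are functions Subset n → ℚ (only values on the relevant faces matter).
-- Coboundary of a cochain f on the faces with c elements, evaluated at H:
-- (δ f)(H) = Σ_{G, |G| = c} [H : G] f(G).
-- (With complete (k-1)-skeleton, all sets of size ≤ k are faces.)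
δ : {n : ℕ} → (c : ℕ) → (Subset n → ℚ) → Subset n → ℚ
δ {n} c f H = Σ[ sets n c ] (λ G → [ H ∶ G ] * f G)

⟪_,_⟫ : {n : ℕ} → {k : ℕ} → (Subset n → ℚ) → (Subset n → ℚ) → ℚ
⟪_,_⟫ {n} {k} f g = Σ[ sets n k ] (λ F → f F * g F)

-- A k-dimensional complex with vertex set [n] and complete (k-1)-skeleton is
-- given by its set of k-faces: a Boolean predicate K on subsets, true only on
-- (k+1)-element sets.
kFaces : (n k : ℕ) → (Subset n → Bool) → List (Subset n)
kFaces n k K = filter (λ S → K S BoolP.≟ true) (sets n (suc k))

Ddeg : (n k : ℕ) → (Subset n → Bool) → Subset n → ℕ
Ddeg n k K F = length (filter (λ S → F ⊆? S) (kFaces n k K))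

Eop : (n k : ℕ) → (Subset n → Bool) → ℚ → (Subset n → ℚ) → Subset n → ℚ
Eop n k K d f H = (ℚ[ Ddeg n k K H ] - d) * f H

hb : {n : ℕ} → (Subset n → ℚ) → Subset n → ℚ
hb {n} b F = Σ[ filter (λ v → ¬? (v ∈? F)) (allFinL n) ]
               (λ v → [ F ∪ ⁅ v ⁆ ∶ F ] * b (F ∪ ⁅ v ⁆))

{-# OPTIONS --safe #-}
module Submission where

open import Defs
open import Data.Bool using (Bool; true; false)
open import Data.Nat as ℕ using (ℕ; zero; suc; _∸_; _≤_; NonZero; s≤s; z≤n)
open import Data.Nat.Properties using (suc-injective)
open import Data.Nat.Coprimality using (1-coprimeTo) renaming (sym to coprime-sym)
open import Data.Integer as ℤ using (+_)
import Data.Integer.Properties as ℤ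
open import Data.Rational using (ℚ; mkℚ; 0ℚ; 1ℚ; _+_; _*_; _-_; -_; _/_; _<_; nonNegative; nonPositive)
  renaming (_≤_ to _≤ℚ_)
import Data.Rational.Properties as ℚ
open import Data.Rational.Solver using (module +-*-Solver)
open import Data.List using (List; []; _∷_; _++_; map; filter; tabulate) renaming (allFin to allFinL)
open import Data.List.Properties using (map-tabulate)
open import Data.Vec using ([]; _∷_)
open import Data.Vec.Properties using (∷-injectiveʳ)
open import Data.Fin using (Fin; zero; suc)
open import Data.Fin.Subset using (Subset; ∣_∣; _⊆_; ⊥; _∪_; ⁅_⁆) renaming (_-_ to _∖_)
open import Data.Fin.Subset.Properties using (_∈?_; _⊆?_; p─⊥≡p; ∪-identityʳ; s⊆s; out⊆; ⊆-refl)
open import Data.Product using (∃-syntax; _×_; _,_)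
open import Data.Sum using (_⊎_; inj₁; inj₂)
open import Function using (_∘_; id; flip)
open import Relation.Nullary using (¬_; does; yes; no; ¬?; contradiction)
open import Relation.Unary using (Pred; Decidable)
open import Relation.Binary.PropositionalEquality
open +-*-Solver

-- Work on the full simplex 2^[n] with cochains of all degrees at once: let δ⋆ be its
-- coboundary and ∂ the transpose of δ⋆, so that every δ c is a restriction of δ⋆ and h_b = ∂ b.
-- Splitting off the first vertex gives δ⋆ δ⋆ = 0 and δ⋆ ∂ + ∂ δ⋆ = n · id.  As b agrees with
-- δ⋆ g on the (k-1)-faces, δ⋆ h_b = δ⋆ ∂ δ⋆ g = n · δ⋆ g - ∂ δ⋆ δ⋆ g = n · b there, which is (a).
-- Incidence numbers lie in {-1, 0, 1}, a (k-1)-face has k facets and a (k-2)-face has n-k+1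
-- cofacets, so Cauchy–Schwarz applied to the sum in (a) and to h_b = ∂ b, followed by exchanging
-- the order of summation, gives (b) and (c).  (b) holds for every diagonal operator E.

Σ-cong : {A : Set} (xs : List A) {f g : A → ℚ} → (∀ x → f x ≡ g x) → Σ[ xs ] f ≡ Σ[ xs ] g
Σ-cong []       f≗g = refl
Σ-cong (x ∷ xs) f≗g = cong₂ _+_ (f≗g x) (Σ-cong xs f≗g)

Σ-zero : {A : Set} (xs : List A) {f : A → ℚ} → (∀ x → f x ≡ 0ℚ) → Σ[ xs ] f ≡ 0ℚ
Σ-zero []       f≗0 = refl
Σ-zero (x ∷ xs) f≗0 = cong₂ _+_ (f≗0 x) (Σ-zero xs f≗0)

Σ-distrib-+ : {A : Set} (xs : List A) (f g : A → ℚ) →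
              Σ[ xs ] (λ x → f x + g x) ≡ Σ[ xs ] f + Σ[ xs ] g
Σ-distrib-+ []       f g = refl
Σ-distrib-+ (x ∷ xs) f g rewrite Σ-distrib-+ xs f g =
  solve 4 (λ a b c d → (a :+ b) :+ (c :+ d) := (a :+ c) :+ (b :+ d)) refl
    (f x) (g x) (Σ[ xs ] f) (Σ[ xs ] g)

Σ-neg : {A : Set} (xs : List A) (f : A → ℚ) → Σ[ xs ] (λ x → - f x) ≡ - Σ[ xs ] f
Σ-neg []       f = refl
Σ-neg (x ∷ xs) f rewrite Σ-neg xs f = sym (ℚ.neg-distrib-+ (f x) (Σ[ xs ] f))

*-distribˡ-Σ : {A : Set} (c : ℚ) (xs : List A) (f : A → ℚ) →
               Σ[ xs ] (λ x → c * f x) ≡ c * Σ[ xs ] f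
*-distribˡ-Σ c []       f = sym (ℚ.*-zeroʳ c)
*-distribˡ-Σ c (x ∷ xs) f rewrite *-distribˡ-Σ c xs f = sym (ℚ.*-distribˡ-+ c (f x) (Σ[ xs ] f))

*-distribʳ-Σ : {A : Set} (c : ℚ) (xs : List A) (f : A → ℚ) →
               Σ[ xs ] (λ x → f x * c) ≡ Σ[ xs ] f * c
*-distribʳ-Σ c xs f = begin
  Σ[ xs ] (λ x → f x * c)  ≡⟨ Σ-cong xs (λ x → ℚ.*-comm (f x) c) ⟩
  Σ[ xs ] (λ x → c * f x)  ≡⟨ *-distribˡ-Σ c xs f ⟩
  c * Σ[ xs ] f            ≡⟨ ℚ.*-comm c _ ⟩
  Σ[ xs ] f * c            ∎
  where open ≡-Reasoning

Σ-++ : {A : Set} (xs ys : List A) (f : A → ℚ) → Σ[ xs ++ ys ] f ≡ Σ[ xs ] f + Σ[ ys ] f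
Σ-++ []       ys f = sym (ℚ.+-identityˡ _)
Σ-++ (x ∷ xs) ys f rewrite Σ-++ xs ys f = sym (ℚ.+-assoc (f x) _ _)

Σ-map : {A B : Set} (g : A → B) (xs : List A) (f : B → ℚ) → Σ[ map g xs ] f ≡ Σ[ xs ] (f ∘ g)
Σ-map g []       f = refl
Σ-map g (x ∷ xs) f = cong (λ s → f (g x) + s) (Σ-map g xs f)

Σ-comm : {A B : Set} (xs : List A) (ys : List B) (f : A → B → ℚ) →
         Σ[ xs ] (λ x → Σ[ ys ] (f x)) ≡ Σ[ ys ] (λ y → Σ[ xs ] (λ x → f x y))
Σ-comm []       ys f = sym (Σ-zero ys (λ _ → refl))
Σ-comm (x ∷ xs) ys f rewrite Σ-comm xs ys f =
  sym (Σ-distrib-+ ys (f x) (λ y → Σ[ xs ] (λ x → f x y)))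

module _ {A : Set} {ℓ} {P : Pred A ℓ} (P? : Decidable P) where

  Σ-filter-redundant : (xs : List A) (f : A → ℚ) → (∀ x → ¬ P x → f x ≡ 0ℚ) →
                       Σ[ filter P? xs ] f ≡ Σ[ xs ] f
  Σ-filter-redundant []       f f≡0 = refl
  Σ-filter-redundant (x ∷ xs) f f≡0 with P? x
  ... | yes _  = cong (λ s → f x + s) (Σ-filter-redundant xs f f≡0)
  ... | no ¬px = begin
    Σ[ filter P? xs ] f  ≡⟨ Σ-filter-redundant xs f f≡0 ⟩
    Σ[ xs ] f            ≡⟨ ℚ.+-identityˡ _ ⟨
    0ℚ + Σ[ xs ] f       ≡⟨ cong (_+ Σ[ xs ] f) (f≡0 x ¬px) ⟨
    f x + Σ[ xs ] f      ∎
    where open ≡-Reasoning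

  Σ-filter-cong : (xs : List A) {f g : A → ℚ} → (∀ x → P x → f x ≡ g x) →
                  Σ[ filter P? xs ] f ≡ Σ[ filter P? xs ] g
  Σ-filter-cong []       f≗g = refl
  Σ-filter-cong (x ∷ xs) f≗g with P? x
  ... | yes px = cong₂ _+_ (f≗g x px) (Σ-filter-cong xs f≗g)
  ... | no _   = Σ-filter-cong xs f≗g

  Σ-filter-mono-≤ : (xs : List A) {f g : A → ℚ} → (∀ x → P x → f x ≤ℚ g x) →
                    Σ[ filter P? xs ] f ≤ℚ Σ[ filter P? xs ] g
  Σ-filter-mono-≤ []       f≤g = ℚ.≤-refl
  Σ-filter-mono-≤ (x ∷ xs) f≤g with P? x
  ... | yes px = ℚ.+-mono-≤ (f≤g x px) (Σ-filter-mono-≤ xs f≤g)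
  ... | no _   = Σ-filter-mono-≤ xs f≤g

Σ-nonNeg : {A : Set} (xs : List A) {f : A → ℚ} → (∀ x → 0ℚ ≤ℚ f x) → 0ℚ ≤ℚ Σ[ xs ] f
Σ-nonNeg []       0≤f = ℚ.≤-refl
Σ-nonNeg (x ∷ xs) 0≤f = ℚ.+-mono-≤ (0≤f x) (Σ-nonNeg xs 0≤f)

0≤p*p : ∀ p → 0ℚ ≤ℚ p * p
0≤p*p p with ℚ.≤-total 0ℚ p
... | inj₁ 0≤p = ℚ.nonNegative⁻¹ _ {{ℚ.nonNeg*nonNeg⇒nonNeg p {{nonNegative 0≤p}} p {{nonNegative 0≤p}}}}
... | inj₂ p≤0 = ℚ.nonNegative⁻¹ _ {{ℚ.nonPos*nonPos⇒nonPos p {{nonPositive p≤0}} p {{nonPositive p≤0}}}}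

p≤p+q : ∀ p {q} → 0ℚ ≤ℚ q → p ≤ℚ p + q
p≤p+q p 0≤q = ℚ.≤-trans (ℚ.≤-reflexive (sym (ℚ.+-identityʳ p))) (ℚ.+-monoʳ-≤ p 0≤q)

Σ-Lagrange : {A : Set} (xs : List A) (u v : A → ℚ) (p q : ℚ) →
  Σ[ xs ] (λ z → (p * v z - q * u z) * (p * v z - q * u z))
  ≡ p * p * Σ[ xs ] (λ z → v z * v z) - (p * q + p * q) * Σ[ xs ] (λ z → u z * v z)
    + q * q * Σ[ xs ] (λ z → u z * u z)
Σ-Lagrange []       u v p q =
  solve 2 (λ p q → con 0ℚ := p :* p :* con 0ℚ :- (p :* q :+ p :* q) :* con 0ℚ :+ q :* q :* con 0ℚ) refl p q
Σ-Lagrange (z ∷ xs) u v p q rewrite Σ-Lagrange xs u v p q =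
  solve 7 (λ p q uz vz V S U →
    (p :* vz :- q :* uz) :* (p :* vz :- q :* uz) :+ (p :* p :* V :- (p :* q :+ p :* q) :* S :+ q :* q :* U)
    := p :* p :* (vz :* vz :+ V) :- (p :* q :+ p :* q) :* (uz :* vz :+ S) :+ q :* q :* (uz :* uz :+ U))
    refl p q (u z) (v z) (Σ[ xs ] (λ z → v z * v z)) (Σ[ xs ] (λ z → u z * v z)) (Σ[ xs ] (λ z → u z * u z))

Cauchy-Schwarz : {A : Set} (xs : List A) (u v : A → ℚ) →
  Σ[ xs ] (λ x → u x * v x) * Σ[ xs ] (λ x → u x * v x)
  ≤ℚ Σ[ xs ] (λ x → u x * u x) * Σ[ xs ] (λ x → v x * v x)
Cauchy-Schwarz []       u v = ℚ.≤-refl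
Cauchy-Schwarz (x ∷ xs) u v = begin
  (u x * v x + S) * (u x * v x + S)
    ≡⟨ solve 3 (λ a b S → (a :* b :+ S) :* (a :* b :+ S)
                          := S :* S :+ ((a :* b :+ a :* b) :* S :+ a :* b :* (a :* b)))
               refl (u x) (v x) S ⟩
  S * S + R
    ≤⟨ ℚ.+-monoˡ-≤ R (Cauchy-Schwarz xs u v) ⟩
  U * V + R
    ≤⟨ p≤p+q (U * V + R) (Σ-nonNeg xs (λ z → 0≤p*p (u x * v z - v x * u z))) ⟩
  U * V + R + L
    ≡⟨ cong (λ l → U * V + R + l) (Σ-Lagrange xs u v (u x) (v x)) ⟩
  U * V + R + (u x * u x * V - (u x * v x + u x * v x) * S + v x * v x * U)
    ≡⟨ solve 5 (λ a b S U V → U :* V :+ ((a :* b :+ a :* b) :* S :+ a :* b :* (a :* b))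
                                 :+ (a :* a :* V :- (a :* b :+ a :* b) :* S :+ b :* b :* U)
                             := (a :* a :+ U) :* (b :* b :+ V))
               refl (u x) (v x) S U V ⟩
  (u x * u x + U) * (v x * v x + V)
    ∎
  where
  open ℚ.≤-Reasoning
  S U V R L : ℚ
  S = Σ[ xs ] (λ z → u z * v z)
  U = Σ[ xs ] (λ z → u z * u z)
  V = Σ[ xs ] (λ z → v z * v z)
  R = (u x * v x + u x * v x) * S + u x * v x * (u x * v x)
  L = Σ[ xs ] (λ z → (u x * v z - v x * u z) * (u x * v z - v x * u z))

-- When a³ = a, a x = a · (a² x) and a² (a² x)² = a² x²: Cauchy–Schwarz for a and a² x.
Cauchy-Schwarz-signs : {A : Set} (xs : List A) (a x : A → ℚ) → (∀ y → a y * a y * a y ≡ a y) →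
  Σ[ xs ] (λ y → a y * x y) * Σ[ xs ] (λ y → a y * x y)
  ≤ℚ Σ[ xs ] (λ y → a y * a y) * Σ[ xs ] (λ y → a y * a y * (x y * x y))
Cauchy-Schwarz-signs {A} xs a x a³≡a = begin
  Σ[ xs ] (λ y → a y * x y) * Σ[ xs ] (λ y → a y * x y)
    ≡⟨ cong₂ _*_ ax≡a·a²x ax≡a·a²x ⟩
  Σ[ xs ] (λ y → a y * v y) * Σ[ xs ] (λ y → a y * v y)
    ≤⟨ Cauchy-Schwarz xs a v ⟩
  Σ[ xs ] (λ y → a y * a y) * Σ[ xs ] (λ y → v y * v y)
    ≡⟨ cong (Σ[ xs ] (λ y → a y * a y) *_) (Σ-cong xs v²≡a²x²) ⟩
  Σ[ xs ] (λ y → a y * a y) * Σ[ xs ] (λ y → a y * a y * (x y * x y))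
    ∎
  where
  open ℚ.≤-Reasoning
  v : A → ℚ
  v y = a y * a y * x y
  ax≡a·a²x : Σ[ xs ] (λ y → a y * x y) ≡ Σ[ xs ] (λ y → a y * v y)
  ax≡a·a²x = Σ-cong xs λ y → trans (cong (_* x y) (sym (a³≡a y)))
    (solve 2 (λ a x → a :* a :* a :* x := a :* (a :* a :* x)) refl (a y) (x y))
  v²≡a²x² : ∀ y → v y * v y ≡ a y * a y * (x y * x y)
  v²≡a²x² y = begin-equality
    v y * v y
      ≡⟨ solve 2 (λ a x → a :* a :* x :* (a :* a :* x) := (a :* a :* a) :* (a :* (x :* x))) refl (a y) (x y) ⟩
    a y * a y * a y * (a y * (x y * x y))
      ≡⟨ cong (_* (a y * (x y * x y))) (a³≡a y) ⟩
    a y * (a y * (x y * x y))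
      ≡⟨ ℚ.*-assoc (a y) (a y) (x y * x y) ⟨
    a y * a y * (x y * x y)
      ∎

ℚ[]≡mkℚ : ∀ m → ℚ[ m ] ≡ mkℚ (+ m) 0 (coprime-sym (1-coprimeTo m))
ℚ[]≡mkℚ m = ℚ.normalize-coprime (coprime-sym (1-coprimeTo m))

ℚ[suc] : ∀ m → ℚ[ suc m ] ≡ 1ℚ + ℚ[ m ]
ℚ[suc] m = sym (trans (cong (λ q → 1ℚ + q) (ℚ[]≡mkℚ m))
                      (cong (λ i → (+ 1 ℤ.+ i) / 1) (ℤ.*-identityʳ (+ m))))

ℚ[n]*x+x≡ℚ[1+n]*x : ∀ n x → ℚ[ n ] * x + x ≡ ℚ[ suc n ] * x
ℚ[n]*x+x≡ℚ[1+n]*x n x = trans (solve 2 (λ m x → m :* x :+ x := (con 1ℚ :+ m) :* x) refl ℚ[ n ] x)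
                             (cong (_* x) (sym (ℚ[suc] n)))

1/n*n≡1 : ∀ n .{{_ : NonZero n}} → (+ 1 / n) * ℚ[ n ] ≡ 1ℚ
1/n*n≡1 (suc m) = trans (cong₂ _*_ (ℚ.normalize-coprime (1-coprimeTo (suc m))) (ℚ[]≡mkℚ (suc m)))
                        (ℚ.*-inverseˡ (mkℚ (+ suc m) 0 (coprime-sym (1-coprimeTo (suc m)))))

a≡0⇒a*b≡0 : ∀ {a} b → a ≡ 0ℚ → a * b ≡ 0ℚ
a≡0⇒a*b≡0 b refl = ℚ.*-zeroˡ b

filter-map : ∀ {A B : Set} {ℓ ℓ′} {P : Pred B ℓ} {Q : Pred A ℓ′} (P? : Decidable P) (Q? : Decidable Q) →
             (f : A → B) → (∀ x → does (P? (f x)) ≡ does (Q? x)) →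
             ∀ xs → filter P? (map f xs) ≡ map f (filter Q? xs)
filter-map P? Q? f P∘f≡Q []       = refl
filter-map P? Q? f P∘f≡Q (x ∷ xs) with does (P? (f x)) | does (Q? x) | P∘f≡Q x
... | true  | true  | refl = cong (f x ∷_) (filter-map P? Q? f P∘f≡Q xs)
... | false | false | refl = filter-map P? Q? f P∘f≡Q xs

Cochain : ℕ → Set
Cochain n = Subset n → ℚ

Σ-allSubsets-suc : ∀ n (φ : Cochain (suc n)) →
  Σ[ allSubsets (suc n) ] φ ≡ Σ[ allSubsets n ] (φ ∘ (false ∷_)) + Σ[ allSubsets n ] (φ ∘ (true ∷_))
Σ-allSubsets-suc n φ = trans (Σ-++ (map (false ∷_) (allSubsets n)) (map (true ∷_) (allSubsets n)) φ)
                             (cong₂ _+_ (Σ-map (false ∷_) (allSubsets n) φ) (Σ-map (true ∷_) (allSubsets n) φ))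

Σ-allSubsets-false∷ : ∀ n (φ : Cochain (suc n)) → (∀ S → φ (true ∷ S) ≡ 0ℚ) →
                      Σ[ allSubsets (suc n) ] φ ≡ Σ[ allSubsets n ] (φ ∘ (false ∷_))
Σ-allSubsets-false∷ n φ φ₁≡0 = begin
  Σ[ allSubsets (suc n) ] φ
    ≡⟨ Σ-allSubsets-suc n φ ⟩
  Σ[ allSubsets n ] (φ ∘ (false ∷_)) + Σ[ allSubsets n ] (φ ∘ (true ∷_))
    ≡⟨ cong (λ s → Σ[ allSubsets n ] (φ ∘ (false ∷_)) + s) (Σ-zero (allSubsets n) φ₁≡0) ⟩
  Σ[ allSubsets n ] (φ ∘ (false ∷_)) + 0ℚ
    ≡⟨ ℚ.+-identityʳ _ ⟩
  Σ[ allSubsets n ] (φ ∘ (false ∷_))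
    ∎
  where open ≡-Reasoning

Σ-allSubsets-true∷ : ∀ n (φ : Cochain (suc n)) → (∀ S → φ (false ∷ S) ≡ 0ℚ) →
                     Σ[ allSubsets (suc n) ] φ ≡ Σ[ allSubsets n ] (φ ∘ (true ∷_))
Σ-allSubsets-true∷ n φ φ₀≡0 = begin
  Σ[ allSubsets (suc n) ] φ
    ≡⟨ Σ-allSubsets-suc n φ ⟩
  Σ[ allSubsets n ] (φ ∘ (false ∷_)) + Σ[ allSubsets n ] (φ ∘ (true ∷_))
    ≡⟨ cong (_+ Σ[ allSubsets n ] (φ ∘ (true ∷_))) (Σ-zero (allSubsets n) φ₀≡0) ⟩
  0ℚ + Σ[ allSubsets n ] (φ ∘ (true ∷_))
    ≡⟨ ℚ.+-identityˡ _ ⟩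
  Σ[ allSubsets n ] (φ ∘ (true ∷_))
    ∎
  where open ≡-Reasoning

e-cases : ∀ {n} {F G : Subset n} {q : ℚ} → (G ≡ F → 1ℚ ≡ q) → (G ≢ F → 0ℚ ≡ q) → e F G ≡ q
e-cases {F = F} {G} G≡F⇒1≡q G≢F⇒0≡q with G ≟S F
... | yes G≡F = G≡F⇒1≡q G≡F
... | no G≢F  = G≢F⇒0≡q G≢F

e-refl : ∀ {n} (F : Subset n) → e F F ≡ 1ℚ
e-refl F = e-cases (λ _ → refl) (λ F≢F → contradiction refl F≢F)

e-≢ : ∀ {n} {F G : Subset n} → G ≢ F → e F G ≡ 0ℚ
e-≢ G≢F = e-cases (λ G≡F → contradiction G≡F G≢F) (λ _ → refl)

e-sym : ∀ {n} (F G : Subset n) → e F G ≡ e G F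
e-sym F G = e-cases (λ G≡F → sym (trans (cong (λ X → e X F) G≡F) (e-refl F)))
                    (λ G≢F → sym (e-≢ (G≢F ∘ sym)))

e-∷ : ∀ {n} x (F G : Subset n) → e (x ∷ F) (x ∷ G) ≡ e F G
e-∷ x F G = sym (e-cases (λ G≡F → sym (trans (cong (λ X → e (x ∷ F) (x ∷ X)) G≡F) (e-refl (x ∷ F))))
                         (λ G≢F → sym (e-≢ (G≢F ∘ ∷-injectiveʳ))))

e-cube : ∀ {n} (F G : Subset n) → e F G * e F G * e F G ≡ e F G
e-cube F G with G ≟S F
... | yes _ = refl
... | no _  = refl

-- From here on, e (x ∷ F) (y ∷ G) reduces to 0ℚ when x and y are distinct literal bits.
Σ-e : ∀ n (F : Subset n) (φ : Cochain n) → Σ[ allSubsets n ] (λ G → e F G * φ G) ≡ φ F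
Σ-e zero    []          φ = trans (ℚ.+-identityʳ _) (ℚ.*-identityˡ _)
Σ-e (suc n) (false ∷ F) φ = begin
  Σ[ allSubsets (suc n) ] (λ G → e (false ∷ F) G * φ G)
    ≡⟨ Σ-allSubsets-false∷ n (λ G → e (false ∷ F) G * φ G) (λ G → ℚ.*-zeroˡ (φ (true ∷ G))) ⟩
  Σ[ allSubsets n ] (λ G → e (false ∷ F) (false ∷ G) * φ (false ∷ G))
    ≡⟨ Σ-cong (allSubsets n) (λ G → cong (_* φ (false ∷ G)) (e-∷ false F G)) ⟩
  Σ[ allSubsets n ] (λ G → e F G * φ (false ∷ G))
    ≡⟨ Σ-e n F (φ ∘ (false ∷_)) ⟩
  φ (false ∷ F)
    ∎
  where open ≡-Reasoning
Σ-e (suc n) (true ∷ F) φ = begin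
  Σ[ allSubsets (suc n) ] (λ G → e (true ∷ F) G * φ G)
    ≡⟨ Σ-allSubsets-true∷ n (λ G → e (true ∷ F) G * φ G) (λ G → ℚ.*-zeroˡ (φ (false ∷ G))) ⟩
  Σ[ allSubsets n ] (λ G → e (true ∷ F) (true ∷ G) * φ (true ∷ G))
    ≡⟨ Σ-cong (allSubsets n) (λ G → cong (_* φ (true ∷ G)) (e-∷ true F G)) ⟩
  Σ[ allSubsets n ] (λ G → e F G * φ (true ∷ G))
    ≡⟨ Σ-e n F (φ ∘ (true ∷_)) ⟩
  φ (true ∷ F)
    ∎
  where open ≡-Reasoning

filter-tabulate-suc : ∀ {n} {ℓ ℓ′} {P : Pred (Fin (suc n)) ℓ} {Q : Pred (Fin n) ℓ′} →
                      (P? : Decidable P) (Q? : Decidable Q) → (∀ v → does (P? (suc v)) ≡ does (Q? v)) →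
                      filter P? (tabulate suc) ≡ map suc (filter Q? (allFinL n))
filter-tabulate-suc {n} P? Q? P∘suc≡Q =
  trans (cong (filter P?) (sym (map-tabulate id suc))) (filter-map P? Q? suc P∘suc≡Q (allFinL n))

elems-false∷ : ∀ {n} (H : Subset n) → elems (false ∷ H) ≡ map suc (elems H)
elems-false∷ H = filter-tabulate-suc (_∈? (false ∷ H)) (_∈? H) (λ _ → refl)

elems-true∷ : ∀ {n} (H : Subset n) → elems (true ∷ H) ≡ zero ∷ map suc (elems H)
elems-true∷ H = cong (zero ∷_) (filter-tabulate-suc (_∈? (true ∷ H)) (_∈? H) (λ _ → refl))

nonElems : ∀ {n} → Subset n → List (Fin n)
nonElems {n} F = filter (λ v → ¬? (v ∈? F)) (allFinL n)

nonElems-false∷ : ∀ {n} (F : Subset n) → nonElems (false ∷ F) ≡ zero ∷ map suc (nonElems F)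
nonElems-false∷ F =
  cong (zero ∷_) (filter-tabulate-suc (λ v → ¬? (v ∈? (false ∷ F))) (λ v → ¬? (v ∈? F)) (λ _ → refl))

nonElems-true∷ : ∀ {n} (F : Subset n) → nonElems (true ∷ F) ≡ map suc (nonElems F)
nonElems-true∷ F = filter-tabulate-suc (λ v → ¬? (v ∈? (true ∷ F))) (λ v → ¬? (v ∈? F)) (λ _ → refl)

altΣ-map : {A B : Set} (g : A → B) (xs : List A) (f : B → ℚ) → altΣ (map g xs) f ≡ altΣ xs (f ∘ g)
altΣ-map g []       f = refl
altΣ-map g (x ∷ xs) f = cong (λ s → f (g x) - s) (altΣ-map g xs f)

altΣ-cong : {A : Set} (xs : List A) {f g : A → ℚ} → (∀ x → f x ≡ g x) → altΣ xs f ≡ altΣ xs g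
altΣ-cong []       f≗g = refl
altΣ-cong (x ∷ xs) f≗g = cong₂ _-_ (f≗g x) (altΣ-cong xs f≗g)

altΣ-zero : {A : Set} (xs : List A) {f : A → ℚ} → (∀ x → f x ≡ 0ℚ) → altΣ xs f ≡ 0ℚ
altΣ-zero []       f≗0 = refl
altΣ-zero (x ∷ xs) f≗0 rewrite f≗0 x | altΣ-zero xs f≗0 = refl

[false∷∶]-altΣ : ∀ {n} (H : Subset n) G → [ false ∷ H ∶ G ] ≡ altΣ (elems H) (λ v → e (false ∷ (H ∖ v)) G)
[false∷∶]-altΣ H G = trans (cong (λ vs → altΣ vs (λ v → e ((false ∷ H) ∖ v) G)) (elems-false∷ H))
                           (altΣ-map suc (elems H) (λ v → e ((false ∷ H) ∖ v) G))

[true∷∶]-altΣ : ∀ {n} (H : Subset n) G →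
                [ true ∷ H ∶ G ] ≡ e (false ∷ H) G - altΣ (elems H) (λ v → e (true ∷ (H ∖ v)) G)
[true∷∶]-altΣ H G = trans (cong (λ vs → altΣ vs (λ v → e ((true ∷ H) ∖ v) G)) (elems-true∷ H))
                          (cong₂ _-_ (cong (λ X → e (false ∷ X) G) (p─⊥≡p H))
                                     (altΣ-map suc (elems H) (λ v → e ((true ∷ H) ∖ v) G)))

[false∷∶false∷] : ∀ {n} (H G : Subset n) → [ false ∷ H ∶ false ∷ G ] ≡ [ H ∶ G ]
[false∷∶false∷] H G = trans ([false∷∶]-altΣ H (false ∷ G)) (altΣ-cong (elems H) (λ v → e-∷ false (H ∖ v) G))

[false∷∶true∷] : ∀ {n} (H G : Subset n) → [ false ∷ H ∶ true ∷ G ] ≡ 0ℚ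
[false∷∶true∷] H G = trans ([false∷∶]-altΣ H (true ∷ G)) (altΣ-zero (elems H) (λ _ → refl))

[true∷∶false∷] : ∀ {n} (H G : Subset n) → [ true ∷ H ∶ false ∷ G ] ≡ e H G
[true∷∶false∷] H G = begin
  [ true ∷ H ∶ false ∷ G ]
    ≡⟨ [true∷∶]-altΣ H (false ∷ G) ⟩
  e (false ∷ H) (false ∷ G) - altΣ (elems H) (λ v → e (true ∷ (H ∖ v)) (false ∷ G))
    ≡⟨ cong₂ _-_ (e-∷ false H G) (altΣ-zero (elems H) (λ _ → refl)) ⟩
  e H G - 0ℚ
    ≡⟨ ℚ.+-identityʳ (e H G) ⟩
  e H G
    ∎
  where open ≡-Reasoning

[true∷∶true∷] : ∀ {n} (H G : Subset n) → [ true ∷ H ∶ true ∷ G ] ≡ - [ H ∶ G ]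
[true∷∶true∷] H G = begin
  [ true ∷ H ∶ true ∷ G ]
    ≡⟨ [true∷∶]-altΣ H (true ∷ G) ⟩
  e (false ∷ H) (true ∷ G) - altΣ (elems H) (λ v → e (true ∷ (H ∖ v)) (true ∷ G))
    ≡⟨ cong (λ s → 0ℚ - s) (altΣ-cong (elems H) (λ v → e-∷ true (H ∖ v) G)) ⟩
  0ℚ - [ H ∶ G ]
    ≡⟨ ℚ.+-identityˡ (- [ H ∶ G ]) ⟩
  - [ H ∶ G ]
    ∎
  where open ≡-Reasoning

infixr 8 _*ᵥ_

_*ᵥ_ : ∀ {n} → (Subset n → Cochain n) → Cochain n → Cochain n
_*ᵥ_ {n} M f S = Σ[ allSubsets n ] (λ T → M S T * f T)

*ᵥ-cong : ∀ {n} (M : Subset n → Cochain n) {f g : Cochain n} → (∀ T → f T ≡ g T) →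
          ∀ S → (M *ᵥ f) S ≡ (M *ᵥ g) S
*ᵥ-cong {n} M f≗g S = Σ-cong (allSubsets n) (λ T → cong (M S T *_) (f≗g T))

*ᵥ-zero : ∀ {n} (M : Subset n → Cochain n) {f : Cochain n} → (∀ T → f T ≡ 0ℚ) → ∀ S → (M *ᵥ f) S ≡ 0ℚ
*ᵥ-zero {n} M f≗0 S = Σ-zero (allSubsets n) (λ T → trans (cong (M S T *_) (f≗0 T)) (ℚ.*-zeroʳ (M S T)))

*ᵥ-distrib-+ : ∀ {n} (M : Subset n → Cochain n) (f g : Cochain n) S →
               (M *ᵥ (λ T → f T + g T)) S ≡ (M *ᵥ f) S + (M *ᵥ g) S
*ᵥ-distrib-+ {n} M f g S = trans (Σ-cong (allSubsets n) (λ T → ℚ.*-distribˡ-+ (M S T) (f T) (g T)))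
                                 (Σ-distrib-+ (allSubsets n) (λ T → M S T * f T) (λ T → M S T * g T))

*ᵥ-neg : ∀ {n} (M : Subset n → Cochain n) (f : Cochain n) S → (M *ᵥ (λ T → - f T)) S ≡ - (M *ᵥ f) S
*ᵥ-neg {n} M f S = trans (Σ-cong (allSubsets n) (λ T → sym (ℚ.neg-distribʳ-* (M S T) (f T))))
                         (Σ-neg (allSubsets n) (λ T → M S T * f T))

*ᵥ-distrib‿- : ∀ {n} (M : Subset n → Cochain n) (f g : Cochain n) S →
               (M *ᵥ (λ T → f T - g T)) S ≡ (M *ᵥ f) S - (M *ᵥ g) S
*ᵥ-distrib‿- M f g S = trans (*ᵥ-distrib-+ M f (λ T → - g T) S) (cong (λ s → (M *ᵥ f) S + s) (*ᵥ-neg M g S))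

*-distribˡ-*ᵥ : ∀ {n} (M : Subset n → Cochain n) (q : ℚ) (f : Cochain n) S →
                q * (M *ᵥ f) S ≡ (M *ᵥ (λ T → q * f T)) S
*-distribˡ-*ᵥ {n} M q f S = begin
  q * Σ[ allSubsets n ] (λ T → M S T * f T)
    ≡⟨ *-distribˡ-Σ q (allSubsets n) (λ T → M S T * f T) ⟨
  Σ[ allSubsets n ] (λ T → q * (M S T * f T))
    ≡⟨ Σ-cong (allSubsets n) (λ T → solve 3 (λ q m x → q :* (m :* x) := m :* (q :* x)) refl q (M S T) (f T)) ⟩
  Σ[ allSubsets n ] (λ T → M S T * (q * f T))
    ∎
  where open ≡-Reasoning

δ⋆ ∂ : ∀ {n} → Cochain n → Cochain n
δ⋆ f = [_∶_] *ᵥ f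
∂ f = flip [_∶_] *ᵥ f

δ⋆-[] : (f : Cochain 0) → δ⋆ f [] ≡ 0ℚ
δ⋆-[] f = trans (ℚ.+-identityʳ ([ [] ∶ [] ] * f [])) (ℚ.*-zeroˡ (f []))

∂-[] : (f : Cochain 0) → ∂ f [] ≡ 0ℚ
∂-[] f = trans (ℚ.+-identityʳ ([ [] ∶ [] ] * f [])) (ℚ.*-zeroˡ (f []))

δ⋆-false∷ : ∀ {n} (f : Cochain (suc n)) H → δ⋆ f (false ∷ H) ≡ δ⋆ (f ∘ (false ∷_)) H
δ⋆-false∷ {n} f H = begin
  δ⋆ f (false ∷ H)
    ≡⟨ Σ-allSubsets-false∷ n (λ G → [ false ∷ H ∶ G ] * f G)
                             (λ G → a≡0⇒a*b≡0 (f (true ∷ G)) ([false∷∶true∷] H G)) ⟩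
  Σ[ allSubsets n ] (λ G → [ false ∷ H ∶ false ∷ G ] * f (false ∷ G))
    ≡⟨ Σ-cong (allSubsets n) (λ G → cong (_* f (false ∷ G)) ([false∷∶false∷] H G)) ⟩
  δ⋆ (f ∘ (false ∷_)) H
    ∎
  where open ≡-Reasoning

δ⋆-true∷ : ∀ {n} (f : Cochain (suc n)) H → δ⋆ f (true ∷ H) ≡ f (false ∷ H) - δ⋆ (f ∘ (true ∷_)) H
δ⋆-true∷ {n} f H = begin
  δ⋆ f (true ∷ H)
    ≡⟨ Σ-allSubsets-suc n (λ G → [ true ∷ H ∶ G ] * f G) ⟩
  Σ[ allSubsets n ] (λ G → [ true ∷ H ∶ false ∷ G ] * f (false ∷ G))
    + Σ[ allSubsets n ] (λ G → [ true ∷ H ∶ true ∷ G ] * f (true ∷ G))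
    ≡⟨ cong₂ _+_ (Σ-cong (allSubsets n) (λ G → cong (_* f (false ∷ G)) ([true∷∶false∷] H G)))
                 (Σ-cong (allSubsets n) (λ G → trans (cong (_* f (true ∷ G)) ([true∷∶true∷] H G))
                                                     (sym (ℚ.neg-distribˡ-* [ H ∶ G ] (f (true ∷ G)))))) ⟩
  Σ[ allSubsets n ] (λ G → e H G * f (false ∷ G)) + Σ[ allSubsets n ] (λ G → - ([ H ∶ G ] * f (true ∷ G)))
    ≡⟨ cong₂ _+_ (Σ-e n H (f ∘ (false ∷_))) (Σ-neg (allSubsets n) (λ G → [ H ∶ G ] * f (true ∷ G))) ⟩
  f (false ∷ H) - δ⋆ (f ∘ (true ∷_)) H
    ∎
  where open ≡-Reasoning

∂-false∷ : ∀ {n} (f : Cochain (suc n)) F → ∂ f (false ∷ F) ≡ ∂ (f ∘ (false ∷_)) F + f (true ∷ F)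
∂-false∷ {n} f F = begin
  ∂ f (false ∷ F)
    ≡⟨ Σ-allSubsets-suc n (λ T → [ T ∶ false ∷ F ] * f T) ⟩
  Σ[ allSubsets n ] (λ T → [ false ∷ T ∶ false ∷ F ] * f (false ∷ T))
    + Σ[ allSubsets n ] (λ T → [ true ∷ T ∶ false ∷ F ] * f (true ∷ T))
    ≡⟨ cong₂ _+_ (Σ-cong (allSubsets n) (λ T → cong (_* f (false ∷ T)) ([false∷∶false∷] T F)))
                 (Σ-cong (allSubsets n) (λ T → cong (_* f (true ∷ T)) (trans ([true∷∶false∷] T F) (e-sym T F)))) ⟩
  ∂ (f ∘ (false ∷_)) F + Σ[ allSubsets n ] (λ T → e F T * f (true ∷ T))
    ≡⟨ cong (λ s → ∂ (f ∘ (false ∷_)) F + s) (Σ-e n F (f ∘ (true ∷_))) ⟩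
  ∂ (f ∘ (false ∷_)) F + f (true ∷ F)
    ∎
  where open ≡-Reasoning

∂-true∷ : ∀ {n} (f : Cochain (suc n)) F → ∂ f (true ∷ F) ≡ - ∂ (f ∘ (true ∷_)) F
∂-true∷ {n} f F = begin
  ∂ f (true ∷ F)
    ≡⟨ Σ-allSubsets-true∷ n (λ T → [ T ∶ true ∷ F ] * f T)
                            (λ T → a≡0⇒a*b≡0 (f (false ∷ T)) ([false∷∶true∷] T F)) ⟩
  Σ[ allSubsets n ] (λ T → [ true ∷ T ∶ true ∷ F ] * f (true ∷ T))
    ≡⟨ Σ-cong (allSubsets n) (λ T → trans (cong (_* f (true ∷ T)) ([true∷∶true∷] T F))
                                          (sym (ℚ.neg-distribˡ-* [ T ∶ F ] (f (true ∷ T))))) ⟩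
  Σ[ allSubsets n ] (λ T → - ([ T ∶ F ] * f (true ∷ T)))
    ≡⟨ Σ-neg (allSubsets n) (λ T → [ T ∶ F ] * f (true ∷ T)) ⟩
  - ∂ (f ∘ (true ∷_)) F
    ∎
  where open ≡-Reasoning

δ⋆∘δ⋆≡0 : ∀ n (f : Cochain n) H → δ⋆ (δ⋆ f) H ≡ 0ℚ
δ⋆∘δ⋆≡0 zero    f []          = δ⋆-[] (δ⋆ f)
δ⋆∘δ⋆≡0 (suc n) f (false ∷ H) = begin
  δ⋆ (δ⋆ f) (false ∷ H)       ≡⟨ δ⋆-false∷ (δ⋆ f) H ⟩
  δ⋆ (δ⋆ f ∘ (false ∷_)) H    ≡⟨ *ᵥ-cong [_∶_] (δ⋆-false∷ f) H ⟩
  δ⋆ (δ⋆ (f ∘ (false ∷_))) H  ≡⟨ δ⋆∘δ⋆≡0 n (f ∘ (false ∷_)) H ⟩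
  0ℚ                          ∎
  where open ≡-Reasoning
δ⋆∘δ⋆≡0 (suc n) f (true ∷ H) = begin
  δ⋆ (δ⋆ f) (true ∷ H)
    ≡⟨ δ⋆-true∷ (δ⋆ f) H ⟩
  δ⋆ f (false ∷ H) - δ⋆ (δ⋆ f ∘ (true ∷_)) H
    ≡⟨ cong₂ _-_ (δ⋆-false∷ f H) (*ᵥ-cong [_∶_] (δ⋆-true∷ f) H) ⟩
  δ⋆ f₀ H - δ⋆ (λ S → f₀ S - δ⋆ f₁ S) H
    ≡⟨ cong (λ s → δ⋆ f₀ H - s) (*ᵥ-distrib‿- [_∶_] f₀ (δ⋆ f₁) H) ⟩
  δ⋆ f₀ H - (δ⋆ f₀ H - δ⋆ (δ⋆ f₁) H)
    ≡⟨ cong (λ s → δ⋆ f₀ H - (δ⋆ f₀ H - s)) (δ⋆∘δ⋆≡0 n f₁ H) ⟩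
  δ⋆ f₀ H - (δ⋆ f₀ H - 0ℚ)
    ≡⟨ solve 1 (λ x → x :- (x :- con 0ℚ) := con 0ℚ) refl (δ⋆ f₀ H) ⟩
  0ℚ
    ∎
  where
  open ≡-Reasoning
  f₀ f₁ : Cochain n
  f₀ = f ∘ (false ∷_)
  f₁ = f ∘ (true ∷_)

δ⋆∘∂+∂∘δ⋆≡n : ∀ n (f : Cochain n) H → δ⋆ (∂ f) H + ∂ (δ⋆ f) H ≡ ℚ[ n ] * f H
δ⋆∘∂+∂∘δ⋆≡n zero    f []          =
  trans (cong₂ _+_ (δ⋆-[] (∂ f)) (∂-[] (δ⋆ f))) (sym (ℚ.*-zeroˡ (f [])))
δ⋆∘∂+∂∘δ⋆≡n (suc n) f (false ∷ H) = begin
  δ⋆ (∂ f) (false ∷ H) + ∂ (δ⋆ f) (false ∷ H)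
    ≡⟨ cong₂ _+_ (δ⋆-false∷ (∂ f) H) (∂-false∷ (δ⋆ f) H) ⟩
  δ⋆ (∂ f ∘ (false ∷_)) H + (∂ (δ⋆ f ∘ (false ∷_)) H + δ⋆ f (true ∷ H))
    ≡⟨ cong₂ _+_ (trans (*ᵥ-cong [_∶_] (∂-false∷ f) H) (*ᵥ-distrib-+ [_∶_] (∂ f₀) f₁ H))
                 (cong₂ _+_ (*ᵥ-cong (flip [_∶_]) (δ⋆-false∷ f) H) (δ⋆-true∷ f H)) ⟩
  (δ⋆ (∂ f₀) H + δ⋆ f₁ H) + (∂ (δ⋆ f₀) H + (f₀ H - δ⋆ f₁ H))
    ≡⟨ solve 4 (λ a b c x → (a :+ b) :+ (c :+ (x :- b)) := (a :+ c) :+ x) refl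
               (δ⋆ (∂ f₀) H) (δ⋆ f₁ H) (∂ (δ⋆ f₀) H) (f₀ H) ⟩
  (δ⋆ (∂ f₀) H + ∂ (δ⋆ f₀) H) + f₀ H
    ≡⟨ cong (_+ f₀ H) (δ⋆∘∂+∂∘δ⋆≡n n f₀ H) ⟩
  ℚ[ n ] * f₀ H + f₀ H
    ≡⟨ ℚ[n]*x+x≡ℚ[1+n]*x n (f₀ H) ⟩
  ℚ[ suc n ] * f₀ H
    ∎
  where
  open ≡-Reasoning
  f₀ f₁ : Cochain n
  f₀ = f ∘ (false ∷_)
  f₁ = f ∘ (true ∷_)
δ⋆∘∂+∂∘δ⋆≡n (suc n) f (true ∷ H) = begin
  δ⋆ (∂ f) (true ∷ H) + ∂ (δ⋆ f) (true ∷ H)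
    ≡⟨ cong₂ _+_ (δ⋆-true∷ (∂ f) H) (∂-true∷ (δ⋆ f) H) ⟩
  (∂ f (false ∷ H) - δ⋆ (∂ f ∘ (true ∷_)) H) + - ∂ (δ⋆ f ∘ (true ∷_)) H
    ≡⟨ cong₂ _+_ (cong₂ _-_ (∂-false∷ f H)
                             (trans (*ᵥ-cong [_∶_] (∂-true∷ f) H) (*ᵥ-neg [_∶_] (∂ f₁) H)))
                 (cong -_ (trans (*ᵥ-cong (flip [_∶_]) (δ⋆-true∷ f) H)
                                 (*ᵥ-distrib‿- (flip [_∶_]) f₀ (δ⋆ f₁) H))) ⟩
  ((∂ f₀ H + f₁ H) - - δ⋆ (∂ f₁) H) + - (∂ f₀ H - ∂ (δ⋆ f₁) H)
    ≡⟨ solve 4 (λ a x b c → ((a :+ x) :- (:- b)) :+ (:- (a :- c)) := (b :+ c) :+ x) refl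
               (∂ f₀ H) (f₁ H) (δ⋆ (∂ f₁) H) (∂ (δ⋆ f₁) H) ⟩
  (δ⋆ (∂ f₁) H + ∂ (δ⋆ f₁) H) + f₁ H
    ≡⟨ cong (_+ f₁ H) (δ⋆∘∂+∂∘δ⋆≡n n f₁ H) ⟩
  ℚ[ n ] * f₁ H + f₁ H
    ≡⟨ ℚ[n]*x+x≡ℚ[1+n]*x n (f₁ H) ⟩
  ℚ[ suc n ] * f₁ H
    ∎
  where
  open ≡-Reasoning
  f₀ f₁ : Cochain n
  f₀ = f ∘ (false ∷_)
  f₁ = f ∘ (true ∷_)

incidence-support : ∀ {n} (H G : Subset n) → [ H ∶ G ] ≡ 0ℚ ⊎ (G ⊆ H × suc ∣ G ∣ ≡ ∣ H ∣)
incidence-support []          []          = inj₁ refl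
incidence-support (false ∷ H) (false ∷ G) with incidence-support H G
... | inj₁ [H∶G]≡0           = inj₁ (trans ([false∷∶false∷] H G) [H∶G]≡0)
... | inj₂ (G⊆H , codim≡1) = inj₂ (s⊆s G⊆H , codim≡1)
incidence-support (false ∷ H) (true ∷ G)  = inj₁ ([false∷∶true∷] H G)
incidence-support (true ∷ H)  (false ∷ G) with G ≟S H
... | yes refl = inj₂ (out⊆ ⊆-refl , refl)
... | no G≢H   = inj₁ (trans ([true∷∶false∷] H G) (e-≢ G≢H))
incidence-support (true ∷ H)  (true ∷ G)  with incidence-support H G
... | inj₁ [H∶G]≡0           = inj₁ (trans ([true∷∶true∷] H G) (cong -_ [H∶G]≡0))
... | inj₂ (G⊆H , codim≡1) = inj₂ (s⊆s G⊆H , cong suc codim≡1)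

incidence-⊈ : ∀ {n} (H G : Subset n) → ¬ G ⊆ H → [ H ∶ G ] ≡ 0ℚ
incidence-⊈ H G G⊈H with incidence-support H G
... | inj₁ [H∶G]≡0   = [H∶G]≡0
... | inj₂ (G⊆H , _) = contradiction {A = G ⊆ H} G⊆H G⊈H

incidence-codim≢1 : ∀ {n} (H G : Subset n) → suc ∣ G ∣ ≢ ∣ H ∣ → [ H ∶ G ] ≡ 0ℚ
incidence-codim≢1 H G codim≢1 with incidence-support H G
... | inj₁ [H∶G]≡0       = [H∶G]≡0
... | inj₂ (_ , codim≡1) = contradiction codim≡1 codim≢1

incidence-*-cong : ∀ {n} (H G : Subset n) {x y : ℚ} → (suc ∣ G ∣ ≡ ∣ H ∣ → x ≡ y) →
                   [ H ∶ G ] * x ≡ [ H ∶ G ] * y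
incidence-*-cong H G {x} {y} x≡y with incidence-support H G
... | inj₁ [H∶G]≡0       = trans (a≡0⇒a*b≡0 x [H∶G]≡0) (sym (a≡0⇒a*b≡0 y [H∶G]≡0))
... | inj₂ (_ , codim≡1) = cong ([ H ∶ G ] *_) (x≡y codim≡1)

incidence-cube : ∀ {n} (H G : Subset n) → [ H ∶ G ] * [ H ∶ G ] * [ H ∶ G ] ≡ [ H ∶ G ]
incidence-cube []          []          = refl
incidence-cube (false ∷ H) (false ∷ G) rewrite [false∷∶false∷] H G = incidence-cube H G
incidence-cube (false ∷ H) (true ∷ G)  rewrite [false∷∶true∷] H G  = refl
incidence-cube (true ∷ H)  (false ∷ G) rewrite [true∷∶false∷] H G  = e-cube H G
incidence-cube (true ∷ H)  (true ∷ G)  rewrite [true∷∶true∷] H G   =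
  trans (solve 1 (λ a → (:- a) :* (:- a) :* (:- a) := :- (a :* a :* a)) refl [ H ∶ G ]) (cong -_ (incidence-cube H G))

-a*-a≡a*a : ∀ a → - a * - a ≡ a * a
-a*-a≡a*a = solve 1 (λ a → (:- a) :* (:- a) := a :* a) refl

Σ-[H∶G]² : ∀ {n} (H : Subset n) → Σ[ allSubsets n ] (λ G → [ H ∶ G ] * [ H ∶ G ]) ≡ ℚ[ ∣ H ∣ ]
Σ-[H∶G]² []                  = refl
Σ-[H∶G]² {suc n} (false ∷ H) = begin
  Σ[ allSubsets (suc n) ] (λ G → [ false ∷ H ∶ G ] * [ false ∷ H ∶ G ])
    ≡⟨ Σ-allSubsets-false∷ n (λ G → [ false ∷ H ∶ G ] * [ false ∷ H ∶ G ])
                             (λ G → a≡0⇒a*b≡0 [ false ∷ H ∶ true ∷ G ] ([false∷∶true∷] H G)) ⟩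
  Σ[ allSubsets n ] (λ G → [ false ∷ H ∶ false ∷ G ] * [ false ∷ H ∶ false ∷ G ])
    ≡⟨ Σ-cong (allSubsets n) (λ G → cong₂ _*_ ([false∷∶false∷] H G) ([false∷∶false∷] H G)) ⟩
  Σ[ allSubsets n ] (λ G → [ H ∶ G ] * [ H ∶ G ])
    ≡⟨ Σ-[H∶G]² H ⟩
  ℚ[ ∣ H ∣ ]
    ∎
  where open ≡-Reasoning
Σ-[H∶G]² {suc n} (true ∷ H) = begin
  Σ[ allSubsets (suc n) ] (λ G → [ true ∷ H ∶ G ] * [ true ∷ H ∶ G ])
    ≡⟨ Σ-allSubsets-suc n (λ G → [ true ∷ H ∶ G ] * [ true ∷ H ∶ G ]) ⟩
  Σ[ allSubsets n ] (λ G → [ true ∷ H ∶ false ∷ G ] * [ true ∷ H ∶ false ∷ G ])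
    + Σ[ allSubsets n ] (λ G → [ true ∷ H ∶ true ∷ G ] * [ true ∷ H ∶ true ∷ G ])
    ≡⟨ cong₂ _+_ (Σ-cong (allSubsets n) (λ G → cong₂ _*_ ([true∷∶false∷] H G) ([true∷∶false∷] H G)))
                 (Σ-cong (allSubsets n) (λ G → trans (cong₂ _*_ ([true∷∶true∷] H G) ([true∷∶true∷] H G))
                                                     (-a*-a≡a*a [ H ∶ G ]))) ⟩
  Σ[ allSubsets n ] (λ G → e H G * e H G) + Σ[ allSubsets n ] (λ G → [ H ∶ G ] * [ H ∶ G ])
    ≡⟨ cong₂ _+_ (trans (Σ-e n H (e H)) (e-refl H)) (Σ-[H∶G]² H) ⟩
  1ℚ + ℚ[ ∣ H ∣ ]
    ≡⟨ ℚ[suc] ∣ H ∣ ⟨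
  ℚ[ suc ∣ H ∣ ]
    ∎
  where open ≡-Reasoning

Σ-[T∶F]² : ∀ {n} (F : Subset n) → Σ[ allSubsets n ] (λ T → [ T ∶ F ] * [ T ∶ F ]) + ℚ[ ∣ F ∣ ] ≡ ℚ[ n ]
Σ-[T∶F]² []                  = refl
Σ-[T∶F]² {suc n} (false ∷ F) = begin
  Σ[ allSubsets (suc n) ] (λ T → [ T ∶ false ∷ F ] * [ T ∶ false ∷ F ]) + ℚ[ ∣ F ∣ ]
    ≡⟨ cong (_+ ℚ[ ∣ F ∣ ]) (Σ-allSubsets-suc n (λ T → [ T ∶ false ∷ F ] * [ T ∶ false ∷ F ])) ⟩
  (Σ[ allSubsets n ] (λ T → [ false ∷ T ∶ false ∷ F ] * [ false ∷ T ∶ false ∷ F ])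
     + Σ[ allSubsets n ] (λ T → [ true ∷ T ∶ false ∷ F ] * [ true ∷ T ∶ false ∷ F ])) + ℚ[ ∣ F ∣ ]
    ≡⟨ cong (_+ ℚ[ ∣ F ∣ ]) (cong₂ _+_
         (Σ-cong (allSubsets n) (λ T → cong₂ _*_ ([false∷∶false∷] T F) ([false∷∶false∷] T F)))
         (Σ-cong (allSubsets n) (λ T →
           cong₂ _*_ (trans ([true∷∶false∷] T F) (e-sym T F)) ([true∷∶false∷] T F)))) ⟩
  (A + Σ[ allSubsets n ] (λ T → e F T * e T F)) + ℚ[ ∣ F ∣ ]
    ≡⟨ cong (λ s → (A + s) + ℚ[ ∣ F ∣ ]) (trans (Σ-e n F (λ T → e T F)) (e-refl F)) ⟩
  (A + 1ℚ) + ℚ[ ∣ F ∣ ]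
    ≡⟨ solve 2 (λ a m → (a :+ con 1ℚ) :+ m := con 1ℚ :+ (a :+ m)) refl A ℚ[ ∣ F ∣ ] ⟩
  1ℚ + (A + ℚ[ ∣ F ∣ ])
    ≡⟨ cong (λ s → 1ℚ + s) (Σ-[T∶F]² F) ⟩
  1ℚ + ℚ[ n ]
    ≡⟨ ℚ[suc] n ⟨
  ℚ[ suc n ]
    ∎
  where
  open ≡-Reasoning
  A : ℚ
  A = Σ[ allSubsets n ] (λ T → [ T ∶ F ] * [ T ∶ F ])
Σ-[T∶F]² {suc n} (true ∷ F) = begin
  Σ[ allSubsets (suc n) ] (λ T → [ T ∶ true ∷ F ] * [ T ∶ true ∷ F ]) + ℚ[ suc ∣ F ∣ ]
    ≡⟨ cong₂ _+_ (Σ-allSubsets-true∷ n (λ T → [ T ∶ true ∷ F ] * [ T ∶ true ∷ F ])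
                                       (λ T → a≡0⇒a*b≡0 [ false ∷ T ∶ true ∷ F ] ([false∷∶true∷] T F)))
                 (ℚ[suc] ∣ F ∣) ⟩
  Σ[ allSubsets n ] (λ T → [ true ∷ T ∶ true ∷ F ] * [ true ∷ T ∶ true ∷ F ]) + (1ℚ + ℚ[ ∣ F ∣ ])
    ≡⟨ cong (_+ (1ℚ + ℚ[ ∣ F ∣ ])) (Σ-cong (allSubsets n) (λ T →
         trans (cong₂ _*_ ([true∷∶true∷] T F) ([true∷∶true∷] T F)) (-a*-a≡a*a [ T ∶ F ]))) ⟩
  A + (1ℚ + ℚ[ ∣ F ∣ ])
    ≡⟨ solve 2 (λ a m → a :+ (con 1ℚ :+ m) := con 1ℚ :+ (a :+ m)) refl A ℚ[ ∣ F ∣ ] ⟩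
  1ℚ + (A + ℚ[ ∣ F ∣ ])
    ≡⟨ cong (λ s → 1ℚ + s) (Σ-[T∶F]² F) ⟩
  1ℚ + ℚ[ n ]
    ≡⟨ ℚ[suc] n ⟨
  ℚ[ suc n ]
    ∎
  where
  open ≡-Reasoning
  A : ℚ
  A = Σ[ allSubsets n ] (λ T → [ T ∶ F ] * [ T ∶ F ])

Σ-[T∶F]²≡n-|F| : ∀ {n} (F : Subset n) →
                 Σ[ allSubsets n ] (λ T → [ T ∶ F ] * [ T ∶ F ]) ≡ ℚ[ n ] - ℚ[ ∣ F ∣ ]
Σ-[T∶F]²≡n-|F| {n} F = trans (solve 2 (λ a m → a := (a :+ m) :- m) refl A ℚ[ ∣ F ∣ ])
                             (cong (_- ℚ[ ∣ F ∣ ]) (Σ-[T∶F]² F))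
  where
  A : ℚ
  A = Σ[ allSubsets n ] (λ T → [ T ∶ F ] * [ T ∶ F ])

hb-false∷ : ∀ {n} (b : Cochain (suc n)) F → hb b (false ∷ F) ≡ b (true ∷ F) + hb (b ∘ (false ∷_)) F
hb-false∷ {n} b F = begin
  hb b (false ∷ F)
    ≡⟨ cong (λ vs → Σ[ vs ] term) (nonElems-false∷ F) ⟩
  term zero + Σ[ map suc (nonElems F) ] term
    ≡⟨ cong₂ _+_ term₀≡b (Σ-map suc (nonElems F) term) ⟩
  b (true ∷ F) + Σ[ nonElems F ] (λ v → [ false ∷ (F ∪ ⁅ v ⁆) ∶ false ∷ F ] * b (false ∷ (F ∪ ⁅ v ⁆)))
    ≡⟨ cong (λ s → b (true ∷ F) + s) (Σ-cong (nonElems F) (λ v →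
         cong (_* b (false ∷ (F ∪ ⁅ v ⁆))) ([false∷∶false∷] (F ∪ ⁅ v ⁆) F))) ⟩
  b (true ∷ F) + hb (b ∘ (false ∷_)) F
    ∎
  where
  open ≡-Reasoning
  term : Fin (suc n) → ℚ
  term v = [ (false ∷ F) ∪ ⁅ v ⁆ ∶ false ∷ F ] * b ((false ∷ F) ∪ ⁅ v ⁆)
  term₀≡b : term zero ≡ b (true ∷ F)
  term₀≡b = begin
    [ true ∷ (F ∪ ⊥) ∶ false ∷ F ] * b (true ∷ (F ∪ ⊥))
      ≡⟨ cong (λ X → [ true ∷ X ∶ false ∷ F ] * b (true ∷ X)) (∪-identityʳ F) ⟩
    [ true ∷ F ∶ false ∷ F ] * b (true ∷ F)
      ≡⟨ cong (_* b (true ∷ F)) (trans ([true∷∶false∷] F F) (e-refl F)) ⟩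
    1ℚ * b (true ∷ F)
      ≡⟨ ℚ.*-identityˡ _ ⟩
    b (true ∷ F)
      ∎

hb-true∷ : ∀ {n} (b : Cochain (suc n)) F → hb b (true ∷ F) ≡ - hb (b ∘ (true ∷_)) F
hb-true∷ {n} b F = begin
  hb b (true ∷ F)
    ≡⟨ cong (λ vs → Σ[ vs ] term) (nonElems-true∷ F) ⟩
  Σ[ map suc (nonElems F) ] term
    ≡⟨ Σ-map suc (nonElems F) term ⟩
  Σ[ nonElems F ] (λ v → [ true ∷ (F ∪ ⁅ v ⁆) ∶ true ∷ F ] * b (true ∷ (F ∪ ⁅ v ⁆)))
    ≡⟨ Σ-cong (nonElems F) (λ v →
         trans (cong (_* b (true ∷ (F ∪ ⁅ v ⁆))) ([true∷∶true∷] (F ∪ ⁅ v ⁆) F))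
               (sym (ℚ.neg-distribˡ-* [ F ∪ ⁅ v ⁆ ∶ F ] (b (true ∷ (F ∪ ⁅ v ⁆)))))) ⟩
  Σ[ nonElems F ] (λ v → - ([ F ∪ ⁅ v ⁆ ∶ F ] * b (true ∷ (F ∪ ⁅ v ⁆))))
    ≡⟨ Σ-neg (nonElems F) (λ v → [ F ∪ ⁅ v ⁆ ∶ F ] * b (true ∷ (F ∪ ⁅ v ⁆))) ⟩
  - hb (b ∘ (true ∷_)) F
    ∎
  where
  open ≡-Reasoning
  term : Fin (suc n) → ℚ
  term v = [ (true ∷ F) ∪ ⁅ v ⁆ ∶ true ∷ F ] * b ((true ∷ F) ∪ ⁅ v ⁆)

hb≡∂ : ∀ n (b : Cochain n) F → hb b F ≡ ∂ b F
hb≡∂ zero    b []          = sym (∂-[] b)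
hb≡∂ (suc n) b (false ∷ F) = begin
  hb b (false ∷ F)                      ≡⟨ hb-false∷ b F ⟩
  b (true ∷ F) + hb (b ∘ (false ∷_)) F  ≡⟨ cong (λ s → b (true ∷ F) + s) (hb≡∂ n (b ∘ (false ∷_)) F) ⟩
  b (true ∷ F) + ∂ (b ∘ (false ∷_)) F   ≡⟨ ℚ.+-comm (b (true ∷ F)) _ ⟩
  ∂ (b ∘ (false ∷_)) F + b (true ∷ F)   ≡⟨ ∂-false∷ b F ⟨
  ∂ b (false ∷ F)                       ∎
  where open ≡-Reasoning
hb≡∂ (suc n) b (true ∷ F) = begin
  hb b (true ∷ F)         ≡⟨ hb-true∷ b F ⟩
  - hb (b ∘ (true ∷_)) F  ≡⟨ cong -_ (hb≡∂ n (b ∘ (true ∷_)) F) ⟩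
  - ∂ (b ∘ (true ∷_)) F   ≡⟨ ∂-true∷ b F ⟨
  ∂ b (true ∷ F)          ∎
  where open ≡-Reasoning

Σ-sets≡Σ-allSubsets : ∀ {n} c (H : Subset n) (ψ : Cochain n) → ∣ H ∣ ≡ suc c →
                      (∀ G → [ H ∶ G ] ≡ 0ℚ → ψ G ≡ 0ℚ) → Σ[ sets n c ] ψ ≡ Σ[ allSubsets n ] ψ
Σ-sets≡Σ-allSubsets {n} c H ψ |H|≡c+1 ψ-vanishes = Σ-filter-redundant (λ S → ∣ S ∣ ℕ.≟ c) (allSubsets n) ψ
  (λ G |G|≢c → ψ-vanishes G (incidence-codim≢1 H G (λ codim≡1 →
                 |G|≢c (suc-injective (trans codim≡1 |H|≡c+1)))))

δ≡δ⋆ : ∀ {n} c (f : Cochain n) H → ∣ H ∣ ≡ suc c → δ c f H ≡ δ⋆ f H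
δ≡δ⋆ c f H |H|≡c+1 = Σ-sets≡Σ-allSubsets c H (λ G → [ H ∶ G ] * f G) |H|≡c+1 (λ G → a≡0⇒a*b≡0 (f G))

δ-e : ∀ {n} c (F H : Subset n) → ∣ H ∣ ≡ suc c → δ c (e F) H ≡ [ H ∶ F ]
δ-e {n} c F H |H|≡c+1 = begin
  δ c (e F) H
    ≡⟨ δ≡δ⋆ c (e F) H |H|≡c+1 ⟩
  Σ[ allSubsets n ] (λ G → [ H ∶ G ] * e F G)
    ≡⟨ Σ-cong (allSubsets n) (λ G → ℚ.*-comm [ H ∶ G ] (e F G)) ⟩
  Σ[ allSubsets n ] (λ G → e F G * [ H ∶ G ])
    ≡⟨ Σ-e n F [ H ∶_] ⟩
  [ H ∶ F ]
    ∎
  where open ≡-Reasoning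

δ⋆-cong-shell : ∀ {n} c {f g : Cochain n} → (∀ G → ∣ G ∣ ≡ c → f G ≡ g G) →
               ∀ H → ∣ H ∣ ≡ suc c → δ⋆ f H ≡ δ⋆ g H
δ⋆-cong-shell {n} c f≗g H |H|≡c+1 = Σ-cong (allSubsets n) (λ G →
  incidence-*-cong H G (λ codim≡1 → f≗g G (suc-injective (trans codim≡1 |H|≡c+1))))

∂-cong-shell : ∀ {n} c {f g : Cochain n} → (∀ T → ∣ T ∣ ≡ suc c → f T ≡ g T) →
               ∀ F → ∣ F ∣ ≡ c → ∂ f F ≡ ∂ g F
∂-cong-shell {n} c f≗g F |F|≡c = Σ-cong (allSubsets n) (λ T →
  incidence-*-cong T F (λ codim≡1 → f≗g T (trans (sym codim≡1) (cong suc |F|≡c))))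

δ⋆-hb≡n*b : ∀ n c (b g : Cochain n) → (∀ H → ∣ H ∣ ≡ suc c → b H ≡ δ c g H) →
           ∀ H → ∣ H ∣ ≡ suc c → δ⋆ (hb b) H ≡ ℚ[ n ] * b H
δ⋆-hb≡n*b n c b g b≡δg H |H|≡c+1 = begin
  δ⋆ (hb b) H
    ≡⟨ *ᵥ-cong [_∶_] (hb≡∂ n b) H ⟩
  δ⋆ (∂ b) H
    ≡⟨ δ⋆-cong-shell c (∂-cong-shell c b≡δ⋆g) H |H|≡c+1 ⟩
  δ⋆ (∂ (δ⋆ g)) H
    ≡⟨ ℚ.+-identityʳ _ ⟨
  δ⋆ (∂ (δ⋆ g)) H + 0ℚ
    ≡⟨ cong (λ s → δ⋆ (∂ (δ⋆ g)) H + s) (*ᵥ-zero (flip [_∶_]) (δ⋆∘δ⋆≡0 n g) H) ⟨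
  δ⋆ (∂ (δ⋆ g)) H + ∂ (δ⋆ (δ⋆ g)) H
    ≡⟨ δ⋆∘∂+∂∘δ⋆≡n n (δ⋆ g) H ⟩
  ℚ[ n ] * δ⋆ g H
    ≡⟨ cong (ℚ[ n ] *_) (b≡δ⋆g H |H|≡c+1) ⟨
  ℚ[ n ] * b H
    ∎
  where
  open ≡-Reasoning
  b≡δ⋆g : ∀ T → ∣ T ∣ ≡ suc c → b T ≡ δ⋆ g T
  b≡δ⋆g T |T|≡c+1 = trans (b≡δg T |T|≡c+1) (δ≡δ⋆ c g T |T|≡c+1)

b≡1/n*δ⋆-hb : ∀ n .{{_ : NonZero n}} c (b g : Cochain n) → (∀ H → ∣ H ∣ ≡ suc c → b H ≡ δ c g H) →
             ∀ H → ∣ H ∣ ≡ suc c → b H ≡ (+ 1 / n) * δ⋆ (hb b) H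
b≡1/n*δ⋆-hb n c b g b≡δg H |H|≡c+1 = sym (begin
  (+ 1 / n) * δ⋆ (hb b) H     ≡⟨ cong ((+ 1 / n) *_) (δ⋆-hb≡n*b n c b g b≡δg H |H|≡c+1) ⟩
  (+ 1 / n) * (ℚ[ n ] * b H)  ≡⟨ ℚ.*-assoc (+ 1 / n) ℚ[ n ] (b H) ⟨
  (+ 1 / n) * ℚ[ n ] * b H    ≡⟨ cong (_* b H) (1/n*n≡1 n) ⟩
  1ℚ * b H                    ≡⟨ ℚ.*-identityˡ (b H) ⟩
  b H                         ∎)
  where open ≡-Reasoning

Σ-faces⊆≡δ⋆ : ∀ {n} c (H : Subset n) (h : Cochain n) → ∣ H ∣ ≡ suc c →
             Σ[ filter (λ F → F ⊆? H) (sets n c) ] (λ F → [ H ∶ F ] * h F) ≡ δ⋆ h H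
Σ-faces⊆≡δ⋆ {n} c H h |H|≡c+1 = trans
  (Σ-filter-redundant (λ F → F ⊆? H) (sets n c) (λ F → [ H ∶ F ] * h F)
                      (λ F F⊈H → a≡0⇒a*b≡0 (h F) (incidence-⊈ H F F⊈H)))
  (Σ-sets≡Σ-allSubsets c H (λ F → [ H ∶ F ] * h F) |H|≡c+1 (λ F → a≡0⇒a*b≡0 (h F)))

diagonal-bound-at : ∀ n c (w h b : Cochain n) (u : ℚ) → (∀ H → ∣ H ∣ ≡ suc c → b H ≡ u * δ⋆ h H) →
  ∀ H → ∣ H ∣ ≡ suc c →
  w H * b H * (w H * b H)
  ≤ℚ (ℚ[ suc c ] * u * u) * Σ[ sets n c ] (λ F → (h F * h F) * (w H * δ c (e F) H * (w H * δ c (e F) H)))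
diagonal-bound-at n c w h b u b≡u*δ⋆h H |H|≡c+1 = begin
  w H * b H * (w H * b H)
    ≡⟨ cong (λ q → q * q) wb≡u*S ⟩
  u * S * (u * S)
    ≡⟨ solve 2 (λ u S → u :* S :* (u :* S) := u :* u :* (S :* S)) refl u S ⟩
  u * u * (S * S)
    ≤⟨ ℚ.*-monoˡ-≤-nonNeg (u * u) {{nonNegative (0≤p*p u)}}
                          (Cauchy-Schwarz-signs (allSubsets n) [ H ∶_] x (incidence-cube H)) ⟩
  u * u * (Σ[ allSubsets n ] (λ F → [ H ∶ F ] * [ H ∶ F ]) * X²)
    ≡⟨ cong (λ q → u * u * (q * X²)) (trans (Σ-[H∶G]² H) (cong ℚ[_] |H|≡c+1)) ⟩
  u * u * (ℚ[ suc c ] * X²)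
    ≡⟨ cong (λ q → u * u * (ℚ[ suc c ] * q)) X²≡ΣY ⟩
  u * u * (ℚ[ suc c ] * Σ[ sets n c ] Y)
    ≡⟨ solve 3 (λ u k s → u :* u :* (k :* s) := k :* u :* u :* s) refl u ℚ[ suc c ] (Σ[ sets n c ] Y) ⟩
  ℚ[ suc c ] * u * u * Σ[ sets n c ] Y
    ∎
  where
  open ℚ.≤-Reasoning
  x Y : Cochain n
  x F = w H * h F
  Y F = (h F * h F) * (w H * δ c (e F) H * (w H * δ c (e F) H))
  S X² : ℚ
  S  = δ⋆ x H
  X² = Σ[ allSubsets n ] (λ F → [ H ∶ F ] * [ H ∶ F ] * (x F * x F))
  wb≡u*S : w H * b H ≡ u * S
  wb≡u*S = trans (cong (w H *_) (b≡u*δ⋆h H |H|≡c+1))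
                 (trans (solve 3 (λ w u s → w :* (u :* s) := u :* (w :* s)) refl (w H) u (δ⋆ h H))
                        (cong (u *_) (*-distribˡ-*ᵥ [_∶_] (w H) h H)))
  Y≡[H∶F]²x² : ∀ F → Y F ≡ [ H ∶ F ] * [ H ∶ F ] * (x F * x F)
  Y≡[H∶F]²x² F = trans (cong (λ a → (h F * h F) * (w H * a * (w H * a))) (δ-e c F H |H|≡c+1))
    (solve 3 (λ a w h → (h :* h) :* ((w :* a) :* (w :* a)) := a :* a :* ((w :* h) :* (w :* h)))
             refl [ H ∶ F ] (w H) (h F))
  X²≡ΣY : X² ≡ Σ[ sets n c ] Y
  X²≡ΣY = sym (trans (Σ-sets≡Σ-allSubsets c H Y |H|≡c+1 (λ F [H∶F]≡0 →
                        trans (Y≡[H∶F]²x² F) (a≡0⇒a*b≡0 (x F * x F) (a≡0⇒a*b≡0 [ H ∶ F ] [H∶F]≡0))))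
                     (Σ-cong (allSubsets n) Y≡[H∶F]²x²))

diagonal-bound : ∀ n c (w h b : Cochain n) (u : ℚ) → (∀ H → ∣ H ∣ ≡ suc c → b H ≡ u * δ⋆ h H) →
  Σ[ sets n (suc c) ] (λ H → w H * b H * (w H * b H))
  ≤ℚ (ℚ[ suc c ] * u * u)
     * Σ[ sets n c ] (λ F → (h F * h F) * Σ[ sets n (suc c) ] (λ H → w H * δ c (e F) H * (w H * δ c (e F) H)))
diagonal-bound n c w h b u b≡u*δ⋆h = begin
  Σ[ sets n (suc c) ] (λ H → w H * b H * (w H * b H))
    ≤⟨ Σ-filter-mono-≤ (λ S → ∣ S ∣ ℕ.≟ suc c) (allSubsets n) (diagonal-bound-at n c w h b u b≡u*δ⋆h) ⟩
  Σ[ sets n (suc c) ] (λ H → κ * Σ[ sets n c ] (λ F → Y F H))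
    ≡⟨ *-distribˡ-Σ κ (sets n (suc c)) (λ H → Σ[ sets n c ] (λ F → Y F H)) ⟩
  κ * Σ[ sets n (suc c) ] (λ H → Σ[ sets n c ] (λ F → Y F H))
    ≡⟨ cong (κ *_) (Σ-comm (sets n (suc c)) (sets n c) (λ H F → Y F H)) ⟩
  κ * Σ[ sets n c ] (λ F → Σ[ sets n (suc c) ] (Y F))
    ≡⟨ cong (κ *_) (Σ-cong (sets n c) (λ F →
         *-distribˡ-Σ (h F * h F) (sets n (suc c)) (λ H → wδe F H * wδe F H))) ⟩
  κ * Σ[ sets n c ] (λ F → (h F * h F) * Σ[ sets n (suc c) ] (λ H → wδe F H * wδe F H))
    ∎
  where
  open ℚ.≤-Reasoning
  κ : ℚ
  κ = ℚ[ suc c ] * u * u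
  wδe Y : Subset n → Cochain n
  wδe F H = w H * δ c (e F) H
  Y F H = (h F * h F) * (wδe F H * wδe F H)

Σ-facets²-weighted : ∀ n c (w : Cochain n) →
  Σ[ allSubsets n ] (λ T → Σ[ sets n c ] (λ F → [ T ∶ F ] * [ T ∶ F ]) * w T)
  ≡ ℚ[ suc c ] * Σ[ sets n (suc c) ] w
Σ-facets²-weighted n c w = begin
  Σ[ allSubsets n ] (λ T → N T * w T)
    ≡⟨ Σ-filter-redundant (λ S → ∣ S ∣ ℕ.≟ suc c) (allSubsets n) (λ T → N T * w T) Nw≡0 ⟨
  Σ[ sets n (suc c) ] (λ T → N T * w T)
    ≡⟨ Σ-filter-cong (λ S → ∣ S ∣ ℕ.≟ suc c) (allSubsets n)
                     (λ T |T|≡c+1 → cong (_* w T) (N≡c+1 T |T|≡c+1)) ⟩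
  Σ[ sets n (suc c) ] (λ T → ℚ[ suc c ] * w T)
    ≡⟨ *-distribˡ-Σ ℚ[ suc c ] (sets n (suc c)) w ⟩
  ℚ[ suc c ] * Σ[ sets n (suc c) ] w
    ∎
  where
  open ≡-Reasoning
  N : Cochain n
  N T = Σ[ sets n c ] (λ F → [ T ∶ F ] * [ T ∶ F ])
  N≡c+1 : ∀ T → ∣ T ∣ ≡ suc c → N T ≡ ℚ[ suc c ]
  N≡c+1 T |T|≡c+1 =
    trans (Σ-sets≡Σ-allSubsets c T (λ F → [ T ∶ F ] * [ T ∶ F ]) |T|≡c+1 (λ F → a≡0⇒a*b≡0 [ T ∶ F ]))
          (trans (Σ-[H∶G]² T) (cong ℚ[_] |T|≡c+1))
  Nw≡0 : ∀ T → ∣ T ∣ ≢ suc c → N T * w T ≡ 0ℚ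
  Nw≡0 T |T|≢c+1 = a≡0⇒a*b≡0 (w T) (trans
    (Σ-filter-cong (λ S → ∣ S ∣ ℕ.≟ c) (allSubsets n) (λ F |F|≡c →
      a≡0⇒a*b≡0 [ T ∶ F ] (incidence-codim≢1 T F (λ codim≡1 →
        |T|≢c+1 (trans (sym codim≡1) (cong suc |F|≡c))))))
    (Σ-zero (sets n c) (λ _ → refl)))

ℚ[n]-ℚ[c]≡ℚ[n]-ℚ[1+c]+1 : ∀ n c → ℚ[ n ] - ℚ[ c ] ≡ ℚ[ n ] - ℚ[ suc c ] + 1ℚ
ℚ[n]-ℚ[c]≡ℚ[n]-ℚ[1+c]+1 n c =
  trans (solve 2 (λ m c → m :- c := m :- (con 1ℚ :+ c) :+ con 1ℚ) refl ℚ[ n ] ℚ[ c ])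
        (cong (λ k → ℚ[ n ] - k + 1ℚ) (sym (ℚ[suc] c)))

hb-energy-bound : ∀ n c (b : Cochain n) →
  Σ[ sets n c ] (λ F → hb b F * hb b F)
  ≤ℚ ℚ[ suc c ] * (ℚ[ n ] - ℚ[ suc c ] + 1ℚ) * Σ[ sets n (suc c) ] (λ T → b T * b T)
hb-energy-bound n c b = begin
  Σ[ sets n c ] (λ F → hb b F * hb b F)
    ≤⟨ Σ-filter-mono-≤ (λ S → ∣ S ∣ ℕ.≟ c) (allSubsets n) hb²≤m*W ⟩
  Σ[ sets n c ] (λ F → m * W F)
    ≡⟨ *-distribˡ-Σ m (sets n c) W ⟩
  m * Σ[ sets n c ] W
    ≡⟨ cong (m *_) (Σ-comm (sets n c) (allSubsets n) (λ F T → [ T ∶ F ] * [ T ∶ F ] * (b T * b T))) ⟩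
  m * Σ[ allSubsets n ] (λ T → Σ[ sets n c ] (λ F → [ T ∶ F ] * [ T ∶ F ] * (b T * b T)))
    ≡⟨ cong (m *_) (Σ-cong (allSubsets n) (λ T →
         *-distribʳ-Σ (b T * b T) (sets n c) (λ F → [ T ∶ F ] * [ T ∶ F ]))) ⟩
  m * Σ[ allSubsets n ] (λ T → Σ[ sets n c ] (λ F → [ T ∶ F ] * [ T ∶ F ]) * (b T * b T))
    ≡⟨ cong (m *_) (Σ-facets²-weighted n c (λ T → b T * b T)) ⟩
  m * (ℚ[ suc c ] * P)
    ≡⟨ cong (λ q → q * (ℚ[ suc c ] * P)) (ℚ[n]-ℚ[c]≡ℚ[n]-ℚ[1+c]+1 n c) ⟩
  (ℚ[ n ] - ℚ[ suc c ] + 1ℚ) * (ℚ[ suc c ] * P)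
    ≡⟨ solve 3 (λ r k p → r :* (k :* p) := k :* r :* p) refl (ℚ[ n ] - ℚ[ suc c ] + 1ℚ) ℚ[ suc c ] P ⟩
  ℚ[ suc c ] * (ℚ[ n ] - ℚ[ suc c ] + 1ℚ) * P
    ∎
  where
  open ℚ.≤-Reasoning
  m P : ℚ
  m = ℚ[ n ] - ℚ[ c ]
  P = Σ[ sets n (suc c) ] (λ T → b T * b T)
  W : Cochain n
  W F = Σ[ allSubsets n ] (λ T → [ T ∶ F ] * [ T ∶ F ] * (b T * b T))
  hb²≤m*W : ∀ F → ∣ F ∣ ≡ c → hb b F * hb b F ≤ℚ m * W F
  hb²≤m*W F |F|≡c = begin
    hb b F * hb b F
      ≡⟨ cong (λ q → q * q) (hb≡∂ n b F) ⟩
    ∂ b F * ∂ b F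
      ≤⟨ Cauchy-Schwarz-signs (allSubsets n) (λ T → [ T ∶ F ]) b (λ T → incidence-cube T F) ⟩
    Σ[ allSubsets n ] (λ T → [ T ∶ F ] * [ T ∶ F ]) * W F
      ≡⟨ cong (_* W F) (trans (Σ-[T∶F]²≡n-|F| F) (cong (λ k → ℚ[ n ] - ℚ[ k ]) |F|≡c)) ⟩
    m * W F
      ∎

lemma3p9 : (n k : ℕ) → .{{_ : NonZero n}} → 1 ≤ k
    → (K : Subset n → Bool)
    → (∀ S → K S ≡ true → ∣ S ∣ ≡ suc k)
    → (∃[ S ] K S ≡ true)
    → (d : ℚ) → 0ℚ < d
    → (b : Subset n → ℚ)
    → (∃[ g ] (∀ H → ∣ H ∣ ≡ k → b H ≡ δ (k ∸ 1) g H))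
    → (∀ H → ∣ H ∣ ≡ k →
         b H ≡ (+ 1 / n) * (Σ[ filter (λ F → F ⊆? H) (sets n (k ∸ 1)) ] (λ F → [ H ∶ F ] * hb b F)))
      × (⟪_,_⟫ {n} {k} (Eop n k K d b) (Eop n k K d b)
           ≤ℚ (ℚ[ k ] * (+ 1 / n) * (+ 1 / n))
              * (Σ[ sets n (k ∸ 1) ] (λ F → (hb b F * hb b F)
                   * ⟪_,_⟫ {n} {k} (Eop n k K d (δ (k ∸ 1) (e F))) (Eop n k K d (δ (k ∸ 1) (e F))))))
      × (Σ[ sets n (k ∸ 1) ] (λ F → hb b F * hb b F)
           ≤ℚ ℚ[ k ] * (ℚ[ n ] - ℚ[ k ] + 1ℚ) * ⟪_,_⟫ {n} {k} b b)
lemma3p9 n (suc c) (s≤s z≤n) K _ _ d _ b (g , b≡δg) =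
    (λ H |H|≡k → trans (b≡1/n*δ⋆-hb n c b g b≡δg H |H|≡k)
                       (cong ((+ 1 / n) *_) (sym (Σ-faces⊆≡δ⋆ c H (hb b) |H|≡k))))
  , diagonal-bound n c (λ H → ℚ[ Ddeg n (suc c) K H ] - d) (hb b) b (+ 1 / n) (b≡1/n*δ⋆-hb n c b g b≡δg)
  , hb-energy-bound n c b
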